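{- Let $n\ge 1$ and $k\ge 1$ be integers. In the group algebra $\mathbb{C}[S_n]$, let $s_k=\sum_{\pi\in S_n} R_{k,n}(\pi^{ -1})\,\pi$ (the element describing a $k$-riffle shuffle) and let $c=\frac{1}{n}\sum_{j=1}^n \zeta^j$ (the element describing a cut of the deck at a uniformly random position), where $\zeta$ is the $n$-cycle $1\mapsto 2\mapsto\cdots\mapsto n\mapsto 1$. Then the probability measures on $S_n$ given by the elements $s_k c$ ("a $k$-riffle shuffle followed by a cut") and $c\, s_k$ ("a cut followed by a $k$-riffle shuffle") induce the same probability distribution on the conjugacy classes of $S_n$; i.e. for every conjugacy class $K$ of $S_n$, the sum of the coefficients of $s_kc$ over elements of $K$ equals the sum of the coefficients of $c\,s_k$ over elements of $K$.
   Context: For $\pi\in S_n$, $d(\pi)$ denotes the number of descents of $\pi$, i.e. the number of $i$ with $1\le i\le n-1$ and $\pi(i)>\pi(i+1)$. The $k$-riffle shuffle measure is $R_{k,n}(\pi)=\binom{n+k-d(\pi)-1}{n}/k^n$; it is the probability that a $k$-riffle shuffle (cut the deck into $k$ piles of sizes $j_1,\dots,j_k$ with probability $\binom{n}{j_1,\dots,j_k}/k^n$, then repeatedly drop a card from a pile with probability proportional to its current size) produces $\pi^{ -1}$. An element $\sum_\pi a_\pi \pi$ of the group algebra with nonnegative coefficients summing to 1 is identified with the probability measure $\pi\mapsto a_\pi$. -}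

module Defs where

open import Data.Nat as ℕ using (ℕ; zero; suc; _+_; _∸_; _^_; NonZero; _<ᵇ_)
open import Data.Nat.Properties using (m^n≢0)
open import Data.Nat.DivMod using (_%_; m%n<n)
open import Data.Nat.Combinatorics using (_C_)
open import Data.Fin as Fin using (Fin; toℕ; fromℕ<)
open import Data.Fin.Properties using () renaming (_≟_ to _≟ᶠ_)
open import Data.Vec as Vec using (Vec; []; _∷_; lookup; tabulate; toList)
open import Data.Vec.Properties using () renaming (≡-dec to ≡-decᵛ)
open import Data.List as List using (List; []; _∷_; concatMap; filter; map; upTo; allFin; length)
open import Data.Bool.ListAction using (any)
open import Data.List.Relation.Unary.AllPairs using (AllPairs; allPairs?)
import Data.Bool
open import Data.Bool using (Bool; true; false; if_then_else_)
open import Data.Integer using (+_)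
open import Data.Rational as ℚ using (ℚ; 0ℚ; _/_)
open import Relation.Nullary using (¬?; does)
open import Relation.Binary.PropositionalEquality using (_≢_)

-- A permutation of {0,…,n-1} is represented by its one-line notation:
-- the vector (π(0), …, π(n-1)) with pairwise distinct entries.
Perm : ℕ → Set
Perm n = Vec (Fin n) n

_≟ᵖ_ : ∀ {n} (π σ : Perm n) → _
_≟ᵖ_ = ≡-decᵛ _≟ᶠ_

allVecs : (n m : ℕ) → List (Vec (Fin n) m)
allVecs n zero    = [] ∷ []
allVecs n (suc m) = concatMap (λ i → map (i ∷_) (allVecs n m)) (allFin n)

Sₙ : (n : ℕ) → List (Perm n)
Sₙ n = filter (λ v → allPairs? (λ x y → ¬? (x ≟ᶠ y)) (toList v)) (allVecs n n)

_∘ᵖ_ : ∀ {n} → Perm n → Perm n → Perm n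
π ∘ᵖ σ = tabulate (λ i → lookup π (lookup σ i))

idᵖ : ∀ {n} → Perm n
idᵖ = tabulate (λ i → i)

private
  findIdx : ∀ {n} → Perm n → Fin n → List (Fin n) → Fin n
  findIdx π j [] = j
  findIdx π j (i ∷ is) = if does (lookup π i ≟ᶠ j) then i else findIdx π j is

inv : ∀ {n} → Perm n → Perm n
inv {n} π = tabulate (λ j → findIdx π j (allFin n))

descList : ∀ {n} → List (Fin n) → ℕ
descList []           = 0
descList (a ∷ [])     = 0
descList (a ∷ b ∷ xs) = (if toℕ b <ᵇ toℕ a then 1 else 0) + descList (b ∷ xs)

descents : ∀ {n} → Perm n → ℕ
descents π = descList (toList π)

R : (k n : ℕ) → .{{NonZero k}} → Perm n → ℚ
R k n π = (+ ((n + k ∸ descents π ∸ 1) C n)) / (k ^ n)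
  where instance _ = m^n≢0 k n

-- elements of the group algebra ℚ[S_n], given by their coefficient functions
GA : ℕ → Set
GA n = Perm n → ℚ

Σ[_]_ : ∀ {A : Set} → List A → (A → ℚ) → ℚ
Σ[ xs ] f = List.foldr (λ x acc → f x ℚ.+ acc) 0ℚ xs

_⋆_ : ∀ {n} → GA n → GA n → GA n
_⋆_ {n} a b ρ = Σ[ Sₙ n ] (λ π → Σ[ Sₙ n ] (λ σ →
                  if does ((π ∘ᵖ σ) ≟ᵖ ρ) then a π ℚ.* b σ else 0ℚ))

riffle : (k n : ℕ) → .{{NonZero k}} → GA n
riffle k n π = R k n (inv π)

-- ζ : the n-cycle 1 ↦ 2 ↦ ⋯ ↦ n ↦ 1  (0-based: i ↦ i+1 mod n)
ζ : (n : ℕ) → .{{NonZero n}} → Perm n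
ζ n = tabulate (λ i → fromℕ< (m%n<n (suc (toℕ i)) n))

_^ᵖ_ : ∀ {n} → Perm n → ℕ → Perm n
π ^ᵖ zero  = idᵖ
π ^ᵖ suc j = π ∘ᵖ (π ^ᵖ j)

cut : (n : ℕ) → .{{NonZero n}} → GA n
cut n ρ = Σ[ List.map suc (upTo n) ] (λ j →
            if does ((ζ n ^ᵖ j) ≟ᵖ ρ) then (+ 1) / n else 0ℚ)

conjugateᵇ : ∀ {n} → Perm n → Perm n → Bool
conjugateᵇ {n} σ π = any (λ τ → does (σ ≟ᵖ ((τ ∘ᵖ π) ∘ᵖ inv τ))) (Sₙ n)

classMass : ∀ {n} → GA n → Perm n → ℚ
classMass {n} a π = Σ[ filter (λ σ → Data.Bool._≟_ (conjugateᵇ σ π) true) (Sₙ n) ] a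

-- For any a, b in the group algebra, the mass of a b on a conjugacy class K is the
-- sum of a(α) b(β) over the pairs (α, β) with α β ∈ K, and that of b a is the same
-- sum over the pairs with β α ∈ K.  The two conditions agree because
-- α β = β⁻¹ (β α) β, so nothing specific to the riffle and cut elements is used.
-- Collapsing the sum over ρ ∈ Sₙ onto ρ = α β needs that Sₙ lists every
-- permutation exactly once.

module Submission where

open import Defs
open import Data.Nat using (ℕ; NonZero; suc)
open import Data.Nat.Properties using (1+n≰n)
open import Data.Bool using (Bool; true; false; T; if_then_else_)
import Data.Bool as Bool
open import Data.Product using (∃; _×_; _,_; proj₂)
open import Data.Empty using (⊥)
open import Function using (_∘_; _⇔_; mk⇔; Equivalence)
open import Function.Definitions using (Injective)
open import Data.Fin using (Fin; punchOut)
open import Data.Fin.Properties using (any?; punchOut-injective; injective⇒≤; _≟_)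
open import Data.Vec as Vec using (Vec; []; _∷_; lookup; tabulate; toList)
open import Data.Vec.Properties using (lookup∘tabulate; tabulate∘lookup; tabulate-cong; ∷-injectiveʳ)
import Data.Vec.Relation.Unary.All.Properties as VecAll
open import Data.Vec.Relation.Unary.Unique.Propositional using () renaming (Unique to UniqueVec)
open import Data.Vec.Relation.Unary.AllPairs using ([]; _∷_)
import Data.Vec.Relation.Unary.Unique.Propositional.Properties as VecUnique
open import Data.List as List using (List; []; _∷_; filter; allFin)
open import Data.List.Relation.Unary.Any using (here; there)
open import Data.List.Relation.Unary.Any.Properties using (any⁺; any⁻)
import Data.List.Relation.Unary.All as All
import Data.List.Relation.Unary.All.Properties as Allₚ
open import Data.List.Relation.Unary.All using (All; []; _∷_)
import Data.List.Relation.Unary.AllPairs as AllPairs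
open import Data.List.Relation.Unary.AllPairs using (allPairs?)
import Data.List.Relation.Unary.AllPairs.Properties as AllPairsₚ
open import Data.List.Relation.Unary.Unique.Propositional using (Unique; []; _∷_)
import Data.List.Relation.Unary.Unique.Propositional.Properties as Unique
open import Data.List.Membership.Propositional using (_∈_; find; lose)
open import Data.List.Membership.Propositional.Properties
  using (∈-allFin; ∈-map⁺; ∈-map⁻; ∈-concatMap⁺; ∈-filter⁺; ∈-filter⁻)
open import Data.Rational using (ℚ; 0ℚ; _+_; _*_)
open import Data.Rational.Properties using (+-identityˡ; +-identityʳ; *-comm; +-0-commutativeMonoid)
open import Algebra.Bundles using (CommutativeMonoid)
open import Algebra.Properties.CommutativeSemigroup (CommutativeMonoid.commutativeSemigroup +-0-commutativeMonoid)
  using (interchange)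
open import Relation.Nullary using (Dec; does; yes; no; ¬?)
open import Relation.Nullary.Reflects using (fromEquivalence; T-reflects-elim)
open import Relation.Nullary.Negation using (contradiction)
open import Relation.Unary using (Decidable)
open import Relation.Binary.Definitions using (DecidableEquality)
open import Relation.Binary.PropositionalEquality
  using (_≡_; _≢_; refl; sym; trans; cong; cong₂; module ≡-Reasoning)

Σ-cong : ∀ {A : Set} (xs : List A) {f g : A → ℚ} →
         (∀ x → x ∈ xs → f x ≡ g x) → Σ[ xs ] f ≡ Σ[ xs ] g
Σ-cong []       f≗g = refl
Σ-cong (x ∷ xs) f≗g = cong₂ _+_ (f≗g x (here refl)) (Σ-cong xs (λ y y∈xs → f≗g y (there y∈xs)))

Σ-zero : ∀ {A : Set} (xs : List A) → Σ[ xs ] (λ _ → 0ℚ) ≡ 0ℚ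
Σ-zero []       = refl
Σ-zero (x ∷ xs) = trans (+-identityˡ _) (Σ-zero xs)

Σ-+ : ∀ {A : Set} (xs : List A) (f g : A → ℚ) →
      Σ[ xs ] (λ x → f x + g x) ≡ Σ[ xs ] f + Σ[ xs ] g
Σ-+ []       f g = sym (+-identityˡ 0ℚ)
Σ-+ (x ∷ xs) f g = trans (cong (f x + g x +_) (Σ-+ xs f g)) (interchange (f x) (g x) _ _)

Σ-comm : ∀ {A B : Set} (xs : List A) (ys : List B) (f : A → B → ℚ) →
         Σ[ xs ] (λ x → Σ[ ys ] (f x)) ≡ Σ[ ys ] (λ y → Σ[ xs ] (λ x → f x y))
Σ-comm []       ys f = sym (Σ-zero ys)
Σ-comm (x ∷ xs) ys f =
  trans (cong (Σ[ ys ] (f x) +_) (Σ-comm xs ys f)) (sym (Σ-+ ys (f x) _))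

if-Σ : ∀ {A : Set} (c : Bool) (xs : List A) (f : A → ℚ) →
       (if c then Σ[ xs ] f else 0ℚ) ≡ Σ[ xs ] (λ x → if c then f x else 0ℚ)
if-Σ true  xs f = refl
if-Σ false xs f = sym (Σ-zero xs)

if-if-comm : ∀ (c d : Bool) (q : ℚ) →
             (if c then (if d then q else 0ℚ) else 0ℚ) ≡ (if d then (if c then q else 0ℚ) else 0ℚ)
if-if-comm true  d     q = refl
if-if-comm false true  q = refl
if-if-comm false false q = refl

Σ-filter : ∀ {A : Set} {P : A → Set} (P? : Decidable P) (xs : List A) (f : A → ℚ) →
           Σ[ filter P? xs ] f ≡ Σ[ xs ] (λ x → if does (P? x) then f x else 0ℚ)
Σ-filter P? []       f = refl
Σ-filter P? (x ∷ xs) f with does (P? x)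
... | true  = cong (f x +_) (Σ-filter P? xs f)
... | false = trans (Σ-filter P? xs f) (sym (+-identityˡ _))

module _ {A : Set} (_≟ᴬ_ : DecidableEquality A) (f : A → ℚ) where

  Σ-δ-∉ : ∀ {x ys} → All (x ≢_) ys → Σ[ ys ] (λ y → if does (x ≟ᴬ y) then f y else 0ℚ) ≡ 0ℚ
  Σ-δ-∉             []            = refl
  Σ-δ-∉ {x} {y ∷ _} (x≢y ∷ x∉ys) with x ≟ᴬ y
  ... | yes x≡y = contradiction x≡y x≢y
  ... | no  _   = trans (+-identityˡ _) (Σ-δ-∉ x∉ys)

  Σ-δ : ∀ {x xs} → Unique xs → x ∈ xs → Σ[ xs ] (λ y → if does (x ≟ᴬ y) then f y else 0ℚ) ≡ f x
  Σ-δ {x} {y ∷ _} (y∉ys ∷ _) _ with x ≟ᴬ y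
  Σ-δ {x} (y∉ys ∷ _)   _            | yes refl = trans (cong (f x +_) (Σ-δ-∉ y∉ys)) (+-identityʳ _)
  Σ-δ     (_ ∷ _)      (here x≡y)   | no  x≢y  = contradiction x≡y x≢y
  Σ-δ     (_ ∷ ys!)    (there x∈ys) | no  _    = trans (+-identityˡ _) (Σ-δ ys! x∈ys)

Unique-toList⁺ : ∀ {A : Set} {m} {v : Vec A m} → UniqueVec v → Unique (toList v)
Unique-toList⁺ []           = []
Unique-toList⁺ (x∉xs ∷ xs!) = VecAll.toList⁺ x∉xs ∷ Unique-toList⁺ xs!

Unique-toList⁻ : ∀ {A : Set} {m} {v : Vec A m} → Unique (toList v) → UniqueVec v
Unique-toList⁻ {v = []}    []           = []
Unique-toList⁻ {v = _ ∷ _} (x∉xs ∷ xs!) = VecAll.toList⁻ x∉xs ∷ Unique-toList⁻ xs!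

∈-allVecs : ∀ {n m} (v : Vec (Fin n) m) → v ∈ allVecs n m
∈-allVecs                []      = here refl
∈-allVecs {n} {suc m} (i ∷ v) =
  ∈-concatMap⁺ (λ j → List.map (j ∷_) (allVecs n m)) (lose (∈-allFin i) (∈-map⁺ (i ∷_) (∈-allVecs v)))

allVecs-unique : ∀ n m → Unique (allVecs n m)
allVecs-unique n 0       = [] ∷ []
allVecs-unique n (suc m) = Unique.concat⁺
  (Allₚ.map⁺ (All.universal (λ _ → Unique.map⁺ ∷-injectiveʳ (allVecs-unique n m)) (allFin n)))
  (AllPairsₚ.map⁺ (AllPairs.map disjoint (Unique.allFin⁺ n)))
  where
  head-∈-map : ∀ {i v vs} → v ∈ List.map (i ∷_) vs → Vec.head v ≡ i
  head-∈-map {i} v∈ with _ , _ , refl ← ∈-map⁻ (i ∷_) v∈ = refl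
  disjoint : ∀ {i j} → i ≢ j →
             ∀ {v} → v ∈ List.map (i ∷_) (allVecs n m) × v ∈ List.map (j ∷_) (allVecs n m) → ⊥
  disjoint i≢j (v∈ᵢ , v∈ⱼ) = i≢j (trans (sym (head-∈-map v∈ᵢ)) (head-∈-map v∈ⱼ))

unique-toList? : ∀ {n} → Decidable (λ (v : Perm n) → Unique (toList v))
unique-toList? v = allPairs? (λ x y → ¬? (x ≟ y)) (toList v)

Sₙ-unique : ∀ n → Unique (Sₙ n)
Sₙ-unique n = Unique.filter⁺ unique-toList? (allVecs-unique n n)

∈Sₙ⇒injective : ∀ {n} {π : Perm n} → π ∈ Sₙ n → Injective _≡_ _≡_ (lookup π)
∈Sₙ⇒injective π∈ = VecUnique.lookup-injective
  (Unique-toList⁻ (proj₂ (∈-filter⁻ unique-toList? {xs = allVecs _ _} π∈))) _ _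

tabulate-∈Sₙ : ∀ {n} {f : Fin n → Fin n} → Injective _≡_ _≡_ f → tabulate f ∈ Sₙ n
tabulate-∈Sₙ f-inj = ∈-filter⁺ unique-toList? (∈-allVecs _) (Unique-toList⁺ (VecUnique.tabulate⁺ f-inj))

∘ᵖ-∈Sₙ : ∀ {n} {π σ : Perm n} → π ∈ Sₙ n → σ ∈ Sₙ n → π ∘ᵖ σ ∈ Sₙ n
∘ᵖ-∈Sₙ π∈ σ∈ = tabulate-∈Sₙ (λ eq → ∈Sₙ⇒injective σ∈ (∈Sₙ⇒injective π∈ eq))

injective⇒surjective : ∀ {n} {f : Fin n → Fin n} → Injective _≡_ _≡_ f → ∀ j → ∃ λ i → f i ≡ j
injective⇒surjective {suc n} {f} f-inj j with any? (λ i → f i ≟ j)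
... | yes found = found
... | no  ¬found = contradiction (injective⇒≤ g-inj) 1+n≰n
  where
  j≢f : ∀ i → j ≢ f i
  j≢f i j≡fi = ¬found (i , sym j≡fi)
  g : Fin (suc n) → Fin n
  g i = punchOut (j≢f i)
  g-inj : Injective _≡_ _≡_ g
  g-inj {x} {y} eq = f-inj (punchOut-injective (j≢f x) (j≢f y) eq)

lookup-∘ᵖ : ∀ {n} (π σ : Perm n) i → lookup (π ∘ᵖ σ) i ≡ lookup π (lookup σ i)
lookup-∘ᵖ π σ = lookup∘tabulate _

∘ᵖ-assoc : ∀ {n} (π σ ρ : Perm n) → (π ∘ᵖ σ) ∘ᵖ ρ ≡ π ∘ᵖ (σ ∘ᵖ ρ)
∘ᵖ-assoc π σ ρ = tabulate-cong λ i →
  trans (lookup-∘ᵖ π σ (lookup ρ i)) (cong (lookup π) (sym (lookup-∘ᵖ σ ρ i)))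

∘ᵖ-identityʳ : ∀ {n} (π : Perm n) → π ∘ᵖ idᵖ ≡ π
∘ᵖ-identityʳ π = trans (tabulate-cong λ i → cong (lookup π) (lookup∘tabulate _ i)) (tabulate∘lookup π)

search-correct : ∀ {n} (π : Perm n) (j : Fin n) (search : List (Fin n) → Fin n) →
  (∀ i is → search (i ∷ is) ≡ (if does (lookup π i ≟ j) then i else search is)) →
  ∀ {k} is → k ∈ is → lookup π k ≡ j → lookup π (search is) ≡ j
search-correct π j search search-∷ (i ∷ is) k∈ πk≡j rewrite search-∷ i is with lookup π i ≟ j | k∈
... | yes πi≡j | _           = πi≡j
... | no  πi≢j | here refl   = contradiction πk≡j πi≢j
... | no  _    | there k∈is  = search-correct π j search search-∷ is k∈is πk≡j

-- The search performed by inv is private to Defs; inv-search names it through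
-- the meta below, which the with-abstraction over allFin n in lookup-inv solves.
inv-search : ∀ {n} → Perm n → Fin n → List (Fin n) → Fin n
lookup-inv : ∀ {n} (π : Perm n) (j : Fin n) → lookup (inv π) j ≡ inv-search π j (allFin n)

inv-search = _
lookup-inv {n} π j with allFin n
... | _ = lookup∘tabulate _ j

lookup-inv-inverseʳ : ∀ {n} (π : Perm n) {j k} → lookup π k ≡ j → lookup π (lookup (inv π) j) ≡ j
lookup-inv-inverseʳ {n} π {j} {k} πk≡j = trans (cong (lookup π) (lookup-inv π j))
  (search-correct π j (inv-search π j) (λ _ _ → refl) (allFin n) (∈-allFin k) πk≡j)

inv-inverseˡ : ∀ {n} {π : Perm n} → π ∈ Sₙ n → inv π ∘ᵖ π ≡ idᵖ
inv-inverseˡ {π = π} π∈ = tabulate-cong λ k → ∈Sₙ⇒injective π∈ (lookup-inv-inverseʳ π refl)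

inv-inverseʳ : ∀ {n} {π : Perm n} → π ∈ Sₙ n → π ∘ᵖ inv π ≡ idᵖ
inv-inverseʳ {π = π} π∈ = tabulate-cong λ j →
  lookup-inv-inverseʳ π (proj₂ (injective⇒surjective (∈Sₙ⇒injective π∈) j))

conjugate⇒intertwines : ∀ {n} {σ π τ : Perm n} → τ ∈ Sₙ n →
                        σ ≡ (τ ∘ᵖ π) ∘ᵖ inv τ → σ ∘ᵖ τ ≡ τ ∘ᵖ π
conjugate⇒intertwines {σ = σ} {π} {τ} τ∈ σ≡ = begin
  σ ∘ᵖ τ                    ≡⟨ cong (_∘ᵖ τ) σ≡ ⟩
  ((τ ∘ᵖ π) ∘ᵖ inv τ) ∘ᵖ τ  ≡⟨ ∘ᵖ-assoc (τ ∘ᵖ π) (inv τ) τ ⟩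
  (τ ∘ᵖ π) ∘ᵖ (inv τ ∘ᵖ τ)  ≡⟨ cong ((τ ∘ᵖ π) ∘ᵖ_) (inv-inverseˡ τ∈) ⟩
  (τ ∘ᵖ π) ∘ᵖ idᵖ           ≡⟨ ∘ᵖ-identityʳ (τ ∘ᵖ π) ⟩
  τ ∘ᵖ π                    ∎
  where open ≡-Reasoning

intertwines⇒conjugate : ∀ {n} {σ π τ : Perm n} → τ ∈ Sₙ n →
                        σ ∘ᵖ τ ≡ τ ∘ᵖ π → σ ≡ (τ ∘ᵖ π) ∘ᵖ inv τ
intertwines⇒conjugate {σ = σ} {π} {τ} τ∈ στ≡τπ = begin
  σ                    ≡⟨ ∘ᵖ-identityʳ σ ⟨
  σ ∘ᵖ idᵖ             ≡⟨ cong (σ ∘ᵖ_) (inv-inverseʳ τ∈) ⟨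
  σ ∘ᵖ (τ ∘ᵖ inv τ)    ≡⟨ ∘ᵖ-assoc σ τ (inv τ) ⟨
  (σ ∘ᵖ τ) ∘ᵖ inv τ    ≡⟨ cong (_∘ᵖ inv τ) στ≡τπ ⟩
  (τ ∘ᵖ π) ∘ᵖ inv τ    ∎
  where open ≡-Reasoning

intertwines-rotate : ∀ {n} {α β τ π : Perm n} →
                     (α ∘ᵖ β) ∘ᵖ τ ≡ τ ∘ᵖ π → (β ∘ᵖ α) ∘ᵖ (β ∘ᵖ τ) ≡ (β ∘ᵖ τ) ∘ᵖ π
intertwines-rotate {α = α} {β} {τ} {π} αβτ≡τπ = begin
  (β ∘ᵖ α) ∘ᵖ (β ∘ᵖ τ)  ≡⟨ ∘ᵖ-assoc β α (β ∘ᵖ τ) ⟩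
  β ∘ᵖ (α ∘ᵖ (β ∘ᵖ τ))  ≡⟨ cong (β ∘ᵖ_) (∘ᵖ-assoc α β τ) ⟨
  β ∘ᵖ ((α ∘ᵖ β) ∘ᵖ τ)  ≡⟨ cong (β ∘ᵖ_) αβτ≡τπ ⟩
  β ∘ᵖ (τ ∘ᵖ π)         ≡⟨ ∘ᵖ-assoc β τ π ⟨
  (β ∘ᵖ τ) ∘ᵖ π         ∎
  where open ≡-Reasoning

T-does : ∀ {A : Set} (A? : Dec A) → T (does A?) ⇔ A
T-does (yes a)  = mk⇔ (λ _ → a) _
T-does (no ¬a) = mk⇔ (λ ()) ¬a

conjugator? : ∀ {n} (σ π τ : Perm n) → Dec (σ ≡ (τ ∘ᵖ π) ∘ᵖ inv τ)
conjugator? σ π τ = σ ≟ᵖ ((τ ∘ᵖ π) ∘ᵖ inv τ)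

conjugateᵇ-sound : ∀ {n} {σ π : Perm n} → T (conjugateᵇ σ π) → ∃ λ τ → τ ∈ Sₙ n × σ ∘ᵖ τ ≡ τ ∘ᵖ π
conjugateᵇ-sound {n} {σ} {π} σ~π
  with τ , τ∈ , σ≡ ← find (any⁻ (does ∘ conjugator? σ π) (Sₙ n) σ~π) =
  τ , τ∈ , conjugate⇒intertwines {σ = σ} {π} τ∈ (Equivalence.to (T-does (conjugator? σ π τ)) σ≡)

conjugateᵇ-complete : ∀ {n} {σ π τ : Perm n} → τ ∈ Sₙ n → σ ∘ᵖ τ ≡ τ ∘ᵖ π → T (conjugateᵇ σ π)
conjugateᵇ-complete {σ = σ} {π} {τ} τ∈ στ≡τπ = any⁺ (does ∘ conjugator? σ π)
  (lose τ∈ (Equivalence.from (T-does (conjugator? σ π τ)) (intertwines⇒conjugate {σ = σ} {π} τ∈ στ≡τπ)))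

conjugateᵇ-rotate : ∀ {n} {α β π : Perm n} → β ∈ Sₙ n →
                    T (conjugateᵇ (α ∘ᵖ β) π) → T (conjugateᵇ (β ∘ᵖ α) π)
conjugateᵇ-rotate {α = α} {β} {π} β∈ αβ~π
  with τ , τ∈ , αβτ≡τπ ← conjugateᵇ-sound {σ = α ∘ᵖ β} {π} αβ~π =
  conjugateᵇ-complete {σ = β ∘ᵖ α} {π} (∘ᵖ-∈Sₙ β∈ τ∈) (intertwines-rotate {α = α} {β} {τ} {π} αβτ≡τπ)

conjugateᵇ-∘ᵖ-comm : ∀ {n} {α β π : Perm n} → α ∈ Sₙ n → β ∈ Sₙ n →
                     conjugateᵇ (α ∘ᵖ β) π ≡ conjugateᵇ (β ∘ᵖ α) π
conjugateᵇ-∘ᵖ-comm {α = α} {β} {π} α∈ β∈ = T-reflects-elim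
  (fromEquivalence (conjugateᵇ-rotate {α = α} {β} {π} β∈) (conjugateᵇ-rotate {α = β} {α} {π} α∈))

does-≟-true : ∀ c → does (c Bool.≟ true) ≡ c
does-≟-true true  = refl
does-≟-true false = refl

classMass-indicator : ∀ {n} (a : GA n) (π : Perm n) →
                      classMass a π ≡ Σ[ Sₙ n ] (λ σ → if conjugateᵇ σ π then a σ else 0ℚ)
classMass-indicator {n} a π = trans (Σ-filter (λ σ → conjugateᵇ σ π Bool.≟ true) (Sₙ n) a)
  (Σ-cong (Sₙ n) λ σ _ → cong (λ c → if c then a σ else 0ℚ) (does-≟-true (conjugateᵇ σ π)))

classMass-⋆ : ∀ {n} (a b : GA n) (π : Perm n) → classMass (a ⋆ b) π ≡
              Σ[ Sₙ n ] (λ α → Σ[ Sₙ n ] (λ β → if conjugateᵇ (α ∘ᵖ β) π then a α * b β else 0ℚ))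
classMass-⋆ {n} a b π = begin
  classMass (a ⋆ b) π
    ≡⟨ classMass-indicator (a ⋆ b) π ⟩
  Σ[ S ] (λ ρ → if conjugateᵇ ρ π then (a ⋆ b) ρ else 0ℚ)
    ≡⟨ Σ-cong S (λ ρ _ → indicator-inside ρ) ⟩
  Σ[ S ] (λ ρ → Σ[ S ] (λ α → Σ[ S ] (λ β → δ α β ρ)))
    ≡⟨ Σ-comm S S (λ ρ α → Σ[ S ] (λ β → δ α β ρ)) ⟩
  Σ[ S ] (λ α → Σ[ S ] (λ ρ → Σ[ S ] (λ β → δ α β ρ)))
    ≡⟨ Σ-cong S (λ α _ → Σ-comm S S (λ ρ β → δ α β ρ)) ⟩
  Σ[ S ] (λ α → Σ[ S ] (λ β → Σ[ S ] (λ ρ → δ α β ρ)))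
    ≡⟨ Σ-cong S (λ α α∈ → Σ-cong S λ β β∈ → Σ-δ _≟ᵖ_ (w α β) (Sₙ-unique n) (∘ᵖ-∈Sₙ α∈ β∈)) ⟩
  Σ[ S ] (λ α → Σ[ S ] (λ β → w α β (α ∘ᵖ β))) ∎
  where
  open ≡-Reasoning
  S = Sₙ n
  w : Perm n → Perm n → Perm n → ℚ
  w α β ρ = if conjugateᵇ ρ π then a α * b β else 0ℚ
  δ : Perm n → Perm n → Perm n → ℚ
  δ α β ρ = if does ((α ∘ᵖ β) ≟ᵖ ρ) then w α β ρ else 0ℚ
  indicator-inside : ∀ ρ → (if conjugateᵇ ρ π then (a ⋆ b) ρ else 0ℚ) ≡
                           Σ[ S ] (λ α → Σ[ S ] (λ β → δ α β ρ))
  indicator-inside ρ = trans (if-Σ c S _) (Σ-cong S λ α _ → trans (if-Σ c S _) (Σ-cong S λ β _ →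
    if-if-comm c (does ((α ∘ᵖ β) ≟ᵖ ρ)) (a α * b β)))
    where c = conjugateᵇ ρ π

classMass-⋆-comm : ∀ {n} (a b : GA n) (π : Perm n) → classMass (a ⋆ b) π ≡ classMass (b ⋆ a) π
classMass-⋆-comm {n} a b π = begin
  classMass (a ⋆ b) π
    ≡⟨ classMass-⋆ a b π ⟩
  Σ[ S ] (λ α → Σ[ S ] (λ β → term a b α β))
    ≡⟨ Σ-comm S S (term a b) ⟩
  Σ[ S ] (λ β → Σ[ S ] (λ α → term a b α β))
    ≡⟨ Σ-cong S (λ β β∈ → Σ-cong S {g = term b a β} λ α α∈ → term-swap α∈ β∈) ⟩
  Σ[ S ] (λ β → Σ[ S ] (λ α → term b a β α))
    ≡⟨ classMass-⋆ b a π ⟨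
  classMass (b ⋆ a) π ∎
  where
  open ≡-Reasoning
  S = Sₙ n
  term : GA n → GA n → Perm n → Perm n → ℚ
  term x y α β = if conjugateᵇ (α ∘ᵖ β) π then x α * y β else 0ℚ
  term-swap : ∀ {α β} → α ∈ S → β ∈ S → term a b α β ≡ term b a β α
  term-swap {α} {β} α∈ β∈ =
    cong₂ (λ c q → if c then q else 0ℚ) (conjugateᵇ-∘ᵖ-comm {π = π} α∈ β∈) (*-comm (a α) (b β))

mainTheorem1 : (n k : ℕ) → {{_ : NonZero n}} → {{_ : NonZero k}} →
    (π : Perm n) → π ∈ Sₙ n →
    classMass (riffle k n ⋆ cut n) π ≡ classMass (cut n ⋆ riffle k n) π
mainTheorem1 n k π _ = classMass-⋆-comm (riffle k n) (cut n) π
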